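{- Let $k\ge 2$ and let $\mathcal F$ be the family over the universe $[2k+1]$ consisting of all $B\subseteq[2k+1]$ such that $\{i,i+1\}\subseteq B$ for some $1\le i\le 2k$ (the up-set generated by $\{\{1,2\},\{2,3\},\dots,\{2k,2k+1\}\}$; it is a $1$-dense family). Then $\mathcal F$ does not have a closure root, i.e. there is no union-closed family $\mathcal H$ over $[2k+1]$ with $\overline{\mathcal H}=\mathcal F$.
   Context: A family of subsets of $[m]$ is union-closed over $[m]$ if it contains $[m]$ and is closed under pairwise unions; the empty set is never a member of any family, and $2^{[m]}$ denotes all nonempty subsets of $[m]$. The closure of a union-closed $\mathcal H$ is $\overline{\mathcal H}=\{A\in 2^{[m]}:\ \mathcal H\cup\{A\}\text{ is union-closed}\}$. A family is $1$-dense if it is not $2^{[m]}$ and its closure is $2^{[m]}$. A closure root of $\mathcal F$ is a union-closed $\mathcal H$ with $\overline{\mathcal H}=\mathcal F$. -}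

module Defs where

open import Data.Nat using (ℕ; suc; _+_)
open import Data.Fin using (Fin; inject₁) renaming (suc to fsuc)
open import Data.Fin.Subset using (Subset; _∈_; _∪_; ⊤; Nonempty)
open import Data.Product using (Σ; _×_; ∃)
open import Data.Sum using (_⊎_)
open import Relation.Binary.PropositionalEquality using (_≡_)

Family : ℕ → Set₁
Family m = Subset m → Set

record UnionClosed {m : ℕ} (H : Family m) : Set where
  field
    members-nonempty : ∀ A → H A → Nonempty A
    has-top          : H ⊤
    ∪-closed         : ∀ A B → H A → H B → H (A ∪ B)

-- H ∪ {A} is union-closed iff H is, A is nonempty, and A ∪ B ∈ H ∪ {A} for every B ∈ H
-- (A ∪ A = A).
addSet : ∀ {m} → Family m → Subset m → Family m
addSet H A B = H B ⊎ (B ≡ A)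

closure : ∀ {m} → Family m → Family m
closure H A = Nonempty A × UnionClosed (addSet H A)

_≐_ : ∀ {m} → Family m → Family m → Set
F ≐ G = ∀ A → (F A → G A) × (G A → F A)

-- The family over [2k+1] of all B containing {i, i+1} for some 1 ≤ i ≤ 2k
-- (0-indexed: positions inject₁ i and suc i for i : Fin (2k)).
pathUpset : (k : ℕ) → Family (suc (k + k))
pathUpset k B = ∃ λ (i : Fin (k + k)) → (inject₁ i ∈ B) × (fsuc i ∈ B)

module Submission where

-- Write m = 2k+1, F for the path up-set and E ⊆ [m] for the set of
-- odd positions {1,3,...,2k+1} (0-indexed: the even indices 0,2,...,2k).  E contains
-- no two consecutive positions, so E ∉ F; we show that E lies in the closure of any
-- union-closed H with closure(H) = F, a contradiction.
--
-- General closure facts come first: a nonempty A is in closure(H) as soon as A ∪ B ∈ H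
-- for every B ∈ H; conversely if A ∈ closure(H), B ∈ H and A ∪ B ≠ A then A ∪ B ∈ H.
-- The second fact yields the filling lemma: if o ∈ B ⊆ S, B ∈ H and S - o ∈ closure(H)
-- then S ∈ H (since (S - o) ∪ B = S ≠ S - o).
--
-- The combinatorial heart: for every B ∈ F there is o ∈ B such that (E ∪ B) - o still
-- contains two consecutive positions.  If B ⊇ {i, i+1} with i even, drop o = i and keep
-- {i+1, i+2} (i+2 ≤ 2k exists because 2k is even); if i is odd, drop o = i+1 and keep
-- {i-1, i}.  Since H ⊆ closure(H) = F, the filling lemma with S = E ∪ B gives
-- E ∪ B ∈ H for all B ∈ H, hence E ∈ closure(H) = F.  The argument works for every k.

open import Defs
open import Data.Nat using (ℕ; _≤_; suc; _+_)
open import Relation.Nullary using (¬_)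
open import Data.Product using (Σ; _×_)

import Data.Nat as ℕ
open import Data.Nat using (zero; s≤s)
open import Data.Nat.Properties using (+-suc; suc-injective; m≤n⇒m<n∨m≡n; <-trans; n<1+n; m<n⇒m<1+n)
open import Data.Bool using (Bool; true; false; not)
open import Data.Bool.Properties using (not-involutive)
open import Data.Fin using (Fin; toℕ; inject₁; fromℕ<; _≟_; _<_) renaming (zero to fzero; suc to fsuc)
open import Data.Fin.Properties using (toℕ-inject₁; toℕ-fromℕ<; toℕ-injective; toℕ<n; <⇒≢; ≤̄⇒inject₁<; ≤-refl)
open import Data.Fin.Subset using (Subset; _∈_; _∪_; _-_; _⊆_; Nonempty)
open import Data.Fin.Subset.Properties
  using (x∈p∪q⁺; x∈p∪q⁻; p⊆p∪q; q⊆p∪q; ∪-comm; ∪-idem; ⊆-antisym; ⊂-irref;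
         p─q⊆p; x∈p∧x≢y⇒x∈p-y; x∈p⇒p-x⊂p)
open import Data.Vec using (tabulate)
open import Data.Vec.Properties using ([]=⇒lookup; lookup⇒[]=; lookup∘tabulate)
open import Data.Product using (_,_; proj₁; proj₂)
open import Data.Sum using (_⊎_; inj₁; inj₂)
open import Relation.Nullary using (yes; no; contradiction)
open import Relation.Binary.PropositionalEquality using (_≡_; _≢_; refl; sym; trans; cong; subst; subst₂)

module _ {m : ℕ} {H : Family m} (uc : UnionClosed H) where
  open UnionClosed uc

  absorbing⇒closure : ∀ {A} → Nonempty A → (∀ B → H B → H (A ∪ B)) → closure H A
  absorbing⇒closure {A} ne absorb = ne , record
    { members-nonempty = nonempty
    ; has-top          = inj₁ has-top
    ; ∪-closed         = closed
    }
    where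
    nonempty : ∀ X → addSet H A X → Nonempty X
    nonempty X (inj₁ hX)   = members-nonempty X hX
    nonempty X (inj₂ refl) = ne

    closed : ∀ X Y → addSet H A X → addSet H A Y → addSet H A (X ∪ Y)
    closed X Y (inj₁ hX)   (inj₁ hY)   = inj₁ (∪-closed X Y hX hY)
    closed X Y (inj₁ hX)   (inj₂ refl) = inj₁ (subst H (∪-comm A X) (absorb X hX))
    closed X Y (inj₂ refl) (inj₁ hY)   = inj₁ (absorb Y hY)
    closed X Y (inj₂ refl) (inj₂ refl) = inj₂ (∪-idem A)

  member⇒closure : ∀ {B} → H B → closure H B
  member⇒closure {B} hB =
    absorbing⇒closure (members-nonempty B hB) (λ C hC → ∪-closed B C hB hC)

closure-∪ : ∀ {m} {H : Family m} {A B} → closure H A → H B → A ∪ B ≢ A → H (A ∪ B)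
closure-∪ {A = A} {B} (_ , ucA) hB A∪B≢A
  with UnionClosed.∪-closed ucA A B (inj₂ refl) (inj₁ hB)
... | inj₁ h  = h
... | inj₂ eq = contradiction eq A∪B≢A

delete-restore : ∀ {n} {B S : Subset n} {o} → o ∈ B → B ⊆ S → (S - o) ∪ B ≡ S
delete-restore {B = B} {S} {o} o∈B B⊆S = ⊆-antisym shrink grow
  where
  shrink : (S - o) ∪ B ⊆ S
  shrink x∈ with x∈p∪q⁻ (S - o) B x∈
  ... | inj₁ x∈S-o = p─q⊆p S _ x∈S-o
  ... | inj₂ x∈B   = B⊆S x∈B

  grow : S ⊆ (S - o) ∪ B
  grow {x} x∈S with x ≟ o
  ... | yes refl = q⊆p∪q (S - o) B o∈B
  ... | no x≢o   = p⊆p∪q B (x∈p∧x≢y⇒x∈p-y x∈S x≢o)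

fill : ∀ {n} {H : Family n} {B S : Subset n} {o} →
       closure H (S - o) → H B → o ∈ B → B ⊆ S → H S
fill {H = H} {B} {S} {o} cl hB o∈B B⊆S = subst H restored (closure-∪ cl hB enlarges)
  where
  restored : (S - o) ∪ B ≡ S
  restored = delete-restore o∈B B⊆S

  -- S - o is a proper subset of S, so adding B back really changes it.
  enlarges : (S - o) ∪ B ≢ S - o
  enlarges eq = ⊂-irref (trans (sym eq) restored) (x∈p⇒p-x⊂p (B⊆S o∈B))

isEven : ℕ → Bool
isEven zero    = true
isEven (suc n) = not (isEven n)

isEven-double : ∀ k → isEven (k + k) ≡ true
isEven-double zero    = refl
isEven-double (suc k) rewrite +-suc k k = trans (not-involutive (isEven (k + k))) (isEven-double k)

even-gap : ∀ {a b} → isEven a ≡ true → isEven b ≡ true → a ℕ.< b → suc a ℕ.< b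
even-gap {a} evA evB a<b with m≤n⇒m<n∨m≡n a<b
... | inj₁ 1+a<b = 1+a<b
... | inj₂ refl  = contradiction (trans (sym (cong not evA)) evB) λ ()

odd⇒suc-even : ∀ n → isEven n ≡ false → Σ ℕ λ p → n ≡ suc p × isEven p ≡ true
odd⇒suc-even (suc p) odd = p , refl , trans (sym (not-involutive (isEven p))) (cong not odd)

evens : (n : ℕ) → Subset n
evens n = tabulate (λ x → isEven (toℕ x))

∈evens⁺ : ∀ {n} {x : Fin n} → isEven (toℕ x) ≡ true → x ∈ evens n
∈evens⁺ {x = x} ev = lookup⇒[]= x _ (trans (lookup∘tabulate _ x) ev)

∈evens⁻ : ∀ {n} {x : Fin n} → x ∈ evens n → isEven (toℕ x) ≡ true
∈evens⁻ {x = x} x∈ = trans (sym (lookup∘tabulate _ x)) ([]=⇒lookup x∈)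

consecutive⇒pathUpset : ∀ k {S} (x y : Fin (suc (k + k))) →
                        toℕ y ≡ suc (toℕ x) → x ∈ S → y ∈ S → pathUpset k S
consecutive⇒pathUpset k {S} x (fsuc i) y≡1+x x∈S y∈S = i , subst (_∈ S) (sym inject₁i≡x) x∈S , y∈S
  where
  inject₁i≡x : inject₁ i ≡ x
  inject₁i≡x = toℕ-injective (trans (toℕ-inject₁ i) (suc-injective y≡1+x))

evens∉pathUpset : ∀ k → ¬ pathUpset k (evens (suc (k + k)))
evens∉pathUpset k (i , left , right) =
  contradiction (trans (sym (cong not evenLeft)) (∈evens⁻ right)) λ ()
  where
  evenLeft : isEven (toℕ i) ≡ true
  evenLeft = trans (cong isEven (sym (toℕ-inject₁ i))) (∈evens⁻ left)

-- The point o
-- is the even one of the consecutive pair i, i+1 in B.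
module _ (k : ℕ) (B : Subset (suc (k + k))) where
  private
    E : Subset (suc (k + k))
    E = evens (suc (k + k))

    keep : ∀ {x o} → x ∈ E ⊎ x ∈ B → x < o ⊎ o < x → x ∈ (E ∪ B) - o
    keep x∈ (inj₁ x<o) = x∈p∧x≢y⇒x∈p-y (x∈p∪q⁺ x∈) (<⇒≢ x<o)
    keep x∈ (inj₂ o<x) = x∈p∧x≢y⇒x∈p-y (x∈p∪q⁺ x∈) (λ x≡o → <⇒≢ o<x (sym x≡o))

    i<1+i : ∀ (i : Fin (k + k)) → inject₁ i < fsuc i
    i<1+i i = ≤̄⇒inject₁< ≤-refl

    Removable : Set
    Removable = Σ (Fin (suc (k + k))) λ o → o ∈ B × pathUpset k ((E ∪ B) - o)

  -- i even: remove i and keep i+1 ∈ B and i+2 ∈ E; i+2 ≤ 2k because 2k is even.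
  removable-even : ∀ i → inject₁ i ∈ B → fsuc i ∈ B → isEven (toℕ i) ≡ true → Removable
  removable-even i i∈B 1+i∈B even = inject₁ i , i∈B ,
    consecutive⇒pathUpset k (fsuc i) next (toℕ-fromℕ< bound)
      (keep (inj₂ 1+i∈B) (inj₂ (i<1+i i)))
      (keep (inj₁ (∈evens⁺ next-even)) (inj₂ i<next))
    where
    bound : suc (suc (toℕ i)) ℕ.< suc (k + k)
    bound = s≤s (even-gap even (isEven-double k) (toℕ<n i))

    next : Fin (suc (k + k))
    next = fromℕ< bound

    next-even : isEven (toℕ next) ≡ true
    next-even = trans (cong isEven (toℕ-fromℕ< bound)) (trans (not-involutive _) even)

    i<next : inject₁ i < next
    i<next = subst₂ ℕ._<_ (sym (toℕ-inject₁ i)) (sym (toℕ-fromℕ< bound))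
                   (m<n⇒m<1+n (n<1+n (toℕ i)))

  -- i = p + 1 odd: remove i+1 and keep p ∈ E and i ∈ B.
  removable-odd : ∀ i p → inject₁ i ∈ B → fsuc i ∈ B →
                  toℕ i ≡ suc p → isEven p ≡ true → Removable
  removable-odd i p i∈B 1+i∈B i≡1+p even = fsuc i , 1+i∈B ,
    consecutive⇒pathUpset k prev (inject₁ i) i≡1+prev
      (keep (inj₁ (∈evens⁺ prev-even)) (inj₁ prev<1+i))
      (keep (inj₂ i∈B) (inj₁ (i<1+i i)))
    where
    bound : p ℕ.< suc (k + k)
    bound = <-trans (n<1+n p)
              (subst (ℕ._< suc (k + k)) (trans (toℕ-inject₁ i) i≡1+p) (toℕ<n (inject₁ i)))

    prev : Fin (suc (k + k))
    prev = fromℕ< bound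

    prev-even : isEven (toℕ prev) ≡ true
    prev-even = trans (cong isEven (toℕ-fromℕ< bound)) even

    i≡1+prev : toℕ (inject₁ i) ≡ suc (toℕ prev)
    i≡1+prev = trans (toℕ-inject₁ i) (trans i≡1+p (cong suc (sym (toℕ-fromℕ< bound))))

    prev<1+i : prev < fsuc i
    prev<1+i = subst₂ ℕ._<_ (sym (toℕ-fromℕ< bound)) (cong suc (sym i≡1+p))
                      (m<n⇒m<1+n (n<1+n p))

  removable-point : pathUpset k B → Removable
  removable-point (i , i∈B , 1+i∈B) with isEven (toℕ i) in parity
  ... | true  = removable-even i i∈B 1+i∈B parity
  ... | false with odd⇒suc-even (toℕ i) parity
  ...   | p , i≡1+p , even = removable-odd i p i∈B 1+i∈B i≡1+p even

-- The even positions E absorb every member B of H (E ∪ B ∈ H), so E ∈ closure(H) = F;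
-- but E contains no two consecutive positions.
corollary5 : ∀ (k : ℕ) → 2 ≤ k →
    ¬ (Σ (Family (suc (k + k))) λ H → UnionClosed H × (closure H ≐ pathUpset k))
corollary5 k _ (H , uc , closure≐F) = evens∉pathUpset k (proj₁ (closure≐F E) E∈closure)
  where
  E : Subset (suc (k + k))
  E = evens (suc (k + k))

  absorbs : ∀ B → H B → H (E ∪ B)
  absorbs B hB with removable-point k B (proj₁ (closure≐F B) (member⇒closure uc hB))
  ... | o , o∈B , pathAfterRemoval =
    fill (proj₂ (closure≐F _) pathAfterRemoval) hB o∈B (q⊆p∪q E B)

  E∈closure : closure H E
  E∈closure = absorbing⇒closure uc (fzero , ∈evens⁺ refl) absorbs
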